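{- Let $\Delta,k,t\ge0$ be integers and let $G$ be a graph of maximum degree at most $\Delta$ with no $(k,t)$-creature. Let $X\subseteq V(G)$ induce a graph isomorphic to $S_{t+1,t+1,t+1}$, and let $x$ be a leaf of $X$. Then the connected component of $G\setminus(N[X\setminus\{x\}]\setminus\{x\})$ containing $x$ contains no $(k-1,t(1+\Delta))$-creature.
   Context: $S_{a,a,a}$ consists of a root $v$ and three paths of length $a$ (number of edges) with one end $v$, whose vertex sets minus $v$ are pairwise disjoint and anticomplete; a leaf is a vertex of degree one. $N[Z]$ is the closed neighbourhood of $Z$. For integers $k>0$, $t\ge0$, a $(k,t)$-creature in a graph $G$ is a pair $(J,\mathcal{P})$ where $J\subseteq V(G)$ is connected, $\mathcal{P}$ is a collection of $k$ pairwise vertex-disjoint and pairwise anticomplete induced paths in $G\setminus J$, each of length $t$, and for every $P\in\mathcal{P}$ some end $v$ of $P$ (the $P$-joint) has a neighbour in $J$ while $V(P)\setminus\{v\}$ is anticomplete to $J$. A graph contains a creature if such a pair exists in it. -}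

module Defs where

open import Data.Nat using (ℕ; zero; suc; _+_; _*_; _∸_; _≤_; _<_; _<ᵇ_; _≡ᵇ_)
open import Data.Fin using (Fin; toℕ; fromℕ) renaming (zero to fzero)
open import Data.Bool using (Bool; true; false; if_then_else_; _∧_; _∨_)
open import Data.List using (List; map; allFin)
open import Data.Nat.ListAction using (sum)
open import Data.Product using (Σ; ∃; _×_; _,_)
open import Data.Sum using (_⊎_)
open import Data.Empty using (⊥)
open import Relation.Nullary using (¬_)
open import Relation.Binary.PropositionalEquality using (_≡_; _≢_)
open import Function.Bundles using (_⇔_)

record Graph : Set₁ where
  field
    n          : ℕ
    adj        : Fin n → Fin n → Bool
    adj-sym    : ∀ u v → adj u v ≡ adj v u
    adj-irrefl : ∀ v → adj v v ≡ false

module _ (G : Graph) where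
  open Graph G

  V : Set
  V = Fin n

  VSet : Set₁
  VSet = V → Set

  Adjacent : V → V → Set
  Adjacent u v = adj u v ≡ true

  degree : V → ℕ
  degree u = sum (map (λ v → if adj u v then 1 else 0) (allFin n))

  MaxDegreeAtMost : ℕ → Set
  MaxDegreeAtMost Δ = ∀ v → degree v ≤ Δ

  data Reach (S : VSet) : V → V → Set where
    here : ∀ {u} → S u → Reach S u u
    step : ∀ {u w v} → S u → Adjacent u w → Reach S w v → Reach S u v

  Connected : VSet → Set
  Connected S = (∃ λ v → S v) × (∀ u v → S u → S v → Reach S u v)

  Component : VSet → V → VSet
  Component S x v = Reach S x v

  ClosedNbhd : VSet → VSet
  ClosedNbhd Z v = Z v ⊎ (∃ λ z → Z z × Adjacent v z)

  HasNbrIn : VSet → V → Set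
  HasNbrIn J v = ∃ λ u → J u × Adjacent v u

  -- an induced path of length t (t edges), vertices p 0, ..., p t
  IsInducedPath : (t : ℕ) → (Fin (suc t) → V) → Set
  IsInducedPath t p =
    (∀ i j → p i ≡ p j → i ≡ j) ×
    (∀ i j → Adjacent (p i) (p j) ⇔ (toℕ i ≡ suc (toℕ j) ⊎ toℕ j ≡ suc (toℕ i)))

  JointCond : (t : ℕ) → VSet → (Fin (suc t) → V) → Set
  JointCond t J p =
    (HasNbrIn J (p fzero) × (∀ a → a ≢ fzero → ¬ HasNbrIn J (p a)))
    ⊎ (HasNbrIn J (p (fromℕ t)) × (∀ a → a ≢ fromℕ t → ¬ HasNbrIn J (p a)))

  CreatureIn : VSet → ℕ → ℕ → Set₁
  CreatureIn S k t =
    0 < k ×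
    Σ VSet λ J → Σ (Fin k → Fin (suc t) → V) λ P →
      (∀ v → J v → S v) ×
      Connected J ×
      (∀ i a → S (P i a)) ×
      (∀ i a → ¬ J (P i a)) ×
      (∀ i → IsInducedPath t (P i)) ×
      (∀ i j → i ≢ j → ∀ a b → (P i a ≢ P j b) × ¬ Adjacent (P i a) (P j b)) ×
      (∀ i → JointCond t J (P i))

  IsLeafOf : VSet → V → Set
  IsLeafOf X x = X x × (∃ λ y → X y × Adjacent x y × (∀ z → X z → Adjacent x z → z ≡ y))

-- The spider S_{a,a,a} on vertex set Fin (1 + 3a): vertex 0 is the root,
-- vertex 1 + b*a + j (b < 3, j < a) is the vertex at distance j+1 from the
-- root on leg b.
spiderDecode : ℕ → ℕ → ℕ × ℕ   -- (leg, position) of a 0-based non-root label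
spiderDecode a l =
  if l <ᵇ a then (0 , l)
  else if l <ᵇ (a + a) then (1 , l ∸ a)
  else (2 , l ∸ (a + a))

spiderAdjℕ : ℕ → ℕ → ℕ → Bool
spiderAdjℕ a zero zero = false
spiderAdjℕ a zero (suc l) with spiderDecode a l
... | (_ , p) = p ≡ᵇ 0
spiderAdjℕ a (suc l) zero with spiderDecode a l
... | (_ , p) = p ≡ᵇ 0
spiderAdjℕ a (suc l) (suc l') with spiderDecode a l | spiderDecode a l'
... | (b , p) | (b' , p') = (b ≡ᵇ b') ∧ ((p ≡ᵇ suc p') ∨ (p' ≡ᵇ suc p))

spiderAdj : (a : ℕ) → Fin (suc (3 * a)) → Fin (suc (3 * a)) → Bool
spiderAdj a i j = spiderAdjℕ a (toℕ i) (toℕ j)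

InducesSpider : (G : Graph) → VSet G → ℕ → Set
InducesSpider G X a =
  Σ (Fin (suc (3 * a)) → V G) λ f →
    (∀ i j → f i ≡ f j → i ≡ j) ×
    (∀ v → X v ⇔ (∃ λ i → f i ≡ v)) ×
    (∀ i j → Graph.adj G (f i) (f j) ≡ spiderAdj a i j)

module Submission where

-- Let (J, P₁, …, P_{k−1}) be a (k−1, t(1+Δ))-creature in the component C of x, each Pⱼ
-- read from its joint, and Z = J ∪ ⋃ Pⱼ. A walk in C from x to J meets N[Z]; let w be its
-- first vertex there, so the walk before w avoids N[Z] and w lies in or next to J ∪ Pᵢ for
-- some i. As w has at most Δ neighbours, each Pⱼ has among its Δ + 1 disjoint blocks of t
-- consecutive inner vertices one that is anticomplete to w, and the subpath of length t
-- ending with that block is kept. The new core J′ consists of J, Pᵢ, the walk up to w, the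
-- other paths up to their kept subpaths, the root and the leg of x. Since C meets
-- N[X ∖ {x}] only in x, the two other legs of the spider are anticomplete to everything
-- in C, so they and the k − 2 kept subpaths form a (k, t)-creature with core J′.

open import Defs
open import Data.Nat using (ℕ; zero; suc; _+_; _*_; _∸_; _≤_; _<_; z≤n; s≤s; _<ᵇ_; _≤?_; _<?_)
open import Data.Nat.Properties
open import Data.Fin using (Fin; toℕ; fromℕ; fromℕ<; punchIn; punchOut; splitAt; join)
  renaming (zero to fzero; suc to fsuc)
open import Data.Fin.Properties
  using (toℕ-fromℕ<; fromℕ<-toℕ; toℕ<n; join-splitAt; toℕ-injective; toℕ-fromℕ; any?; all?; ¬∀⟶∃¬;
         punchIn-injective; punchInᵢ≢i; punchOut-injective; punchIn-punchOut)
  renaming (_≟_ to _≟ᶠ_)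
open import Data.Bool using (Bool; true; false; if_then_else_)
open import Data.Bool.Properties using (T-≡; T-∧; T-∨; ¬-not) renaming (_≟_ to _≟ᵇ_)
open import Data.List using (map; tabulate)
open import Data.List.Properties using (map-tabulate)
open import Data.Nat.ListAction using (sum)
open import Data.Product using (∃; ∃₂; _×_; _,_; proj₁; proj₂)
open import Data.Sum using (_⊎_; inj₁; inj₂; [_,_])
import Data.Sum as Sum
open import Data.Empty using (⊥; ⊥-elim)
open import Data.Unit using (⊤; tt)
open import Relation.Nullary using (¬_; Dec; yes; no)
open import Relation.Nullary.Decidable using (_⊎-dec_; _×-dec_; ¬?; decidable-stable; ¬¬-excluded-middle)
open import Relation.Binary.PropositionalEquality
  using (_≡_; _≢_; refl; sym; trans; cong; subst; subst₂; module ≡-Reasoning)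
open import Relation.Binary.Definitions using (tri<; tri≈; tri>)
open import Function using (_∘_)
open import Function.Bundles using (_⇔_; mk⇔; Equivalence)

¬¬-decidable : ∀ n (P : Fin n → Set) → ¬ ¬ (∀ v → Dec (P v))
¬¬-decidable zero    P k = k (λ ())
¬¬-decidable (suc n) P k = ¬¬-decidable n (P ∘ fsuc) λ P∘suc? →
  ¬¬-excluded-middle λ P0? → k λ { fzero → P0? ; (fsuc v) → P∘suc? v }

module Basics (G : Graph) where

  Adjacent-sym : ∀ {u v} → Adjacent G u v → Adjacent G v u
  Adjacent-sym {u} {v} = trans (Graph.adj-sym G v u)

  Adjacent? : ∀ u v → Dec (Adjacent G u v)
  Adjacent? u v = Graph.adj G u v ≟ᵇ true

  separated-sym : ∀ {u v} → (u ≢ v) × ¬ Adjacent G u v → (v ≢ u) × ¬ Adjacent G v u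
  separated-sym (u≢v , u≁v) = u≢v ∘ sym , u≁v ∘ Adjacent-sym

  reach-source : ∀ {S u v} → Reach G S u v → S u
  reach-source (here s)     = s
  reach-source (step s _ _) = s

  reach-target : ∀ {S u v} → Reach G S u v → S v
  reach-target (here s)     = s
  reach-target (step _ _ r) = reach-target r

  reach-trans : ∀ {S u v w} → Reach G S u v → Reach G S v w → Reach G S u w
  reach-trans (here _)     r′ = r′
  reach-trans (step s a r) r′ = step s a (reach-trans r r′)

  reach-snoc : ∀ {S u v w} → Reach G S u v → Adjacent G v w → S w → Reach G S u w
  reach-snoc r a s = reach-trans r (step (reach-target r) a (here s))

  reach-sym : ∀ {S u v} → Reach G S u v → Reach G S v u
  reach-sym (here s)     = here s
  reach-sym (step s a r) = reach-snoc (reach-sym r) (Adjacent-sym a) s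

  reach-mono : ∀ {S S′ : VSet G} → (∀ {v} → S v → S′ v) → ∀ {u v} → Reach G S u v → Reach G S′ u v
  reach-mono f (here s)     = here (f s)
  reach-mono f (step s a r) = step (f s) a (reach-mono f r)

  reach-prefixes : ∀ {S u v} → Reach G S u v → Reach G (Reach G S u) u v
  reach-prefixes r = go (here (reach-source r)) r
    where
    go : ∀ {S u z v} → Reach G S u z → Reach G S z v → Reach G (Reach G S u) z v
    go pre (here _)     = here pre
    go pre (step _ a r) = step pre a (go (reach-snoc pre a (reach-source r)) r)

  leaf-neighbours-equal : ∀ {X x z z′} → IsLeafOf G X x → X z → X z′ →
    Adjacent G x z → Adjacent G x z′ → z ≡ z′
  leaf-neighbours-equal (_ , _ , _ , _ , unique) z∈X z′∈X xz xz′ =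
    trans (unique _ z∈X xz) (sym (unique _ z′∈X xz′))

  first-hit : ∀ {S P : VSet G} → (∀ v → Dec (P v)) → ∀ {u v} → Reach G S u v → P v →
    P u ⊎ ∃₂ λ u′ w → Reach G (λ z → S z × ¬ P z) u u′ × Adjacent G u′ w × P w × S w
  first-hit P? (here _) pv = inj₁ pv
  first-hit P? {u} (step s a r) pv with P? u | first-hit P? r pv
  ... | yes pu | _ = inj₁ pu
  ... | no ¬pu | inj₁ pw = inj₂ (u , _ , here (s , ¬pu) , a , pw , reach-source r)
  ... | no ¬pu | inj₂ (u′ , w , r′ , a′ , pw , sw) = inj₂ (u′ , w , step (s , ¬pu) a r′ , a′ , pw , sw)

count : (n : ℕ) → (Fin n → Bool) → ℕ
count zero    g = 0
count (suc n) g = (if g fzero then 1 else 0) + count n (g ∘ fsuc)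

sum-indicators≡count : ∀ n (g : Fin n → Bool) → sum (tabulate (λ v → if g v then 1 else 0)) ≡ count n g
sum-indicators≡count zero    g = refl
sum-indicators≡count (suc n) g = cong ((if g fzero then 1 else 0) +_) (sum-indicators≡count n (g ∘ fsuc))

count-head-true : ∀ {n} (g : Fin (suc n) → Bool) → g fzero ≡ true → count (suc n) g ≡ suc (count n (g ∘ fsuc))
count-head-true g e rewrite e = refl

injection⇒≤count : ∀ {m n} (g : Fin n → Bool) (h : Fin m → Fin n) →
  (∀ {i j} → h i ≡ h j → i ≡ j) → (∀ i → g (h i) ≡ true) → m ≤ count n g
injection⇒≤count {zero}  g h inj gh = z≤n
injection⇒≤count {suc m} {zero} g h inj gh with h fzero
... | ()
injection⇒≤count {suc m} {suc n} g h inj gh with any? (λ i → h i ≟ᶠ fzero)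
... | yes (i , hi≡0) =
  subst (suc m ≤_) (sym (count-head-true g (subst (λ v → g v ≡ true) hi≡0 (gh i))))
    (s≤s (injection⇒≤count (g ∘ fsuc) h′ h′-injective (λ j → trans (cong g (punchIn-punchOut (≢0 j))) (gh _))))
  where
  ≢0 : ∀ j → fzero ≢ h (punchIn i j)
  ≢0 j e = punchInᵢ≢i i j (inj (trans (sym e) (sym hi≡0)))
  h′ : Fin m → Fin n
  h′ j = punchOut (≢0 j)
  h′-injective : ∀ {j k} → h′ j ≡ h′ k → j ≡ k
  h′-injective e = punchIn-injective i _ _ (inj (punchOut-injective (≢0 _) (≢0 _) e))
... | no ∄i =
  ≤-trans (injection⇒≤count (g ∘ fsuc) h′ h′-injective (λ j → trans (cong g (punchIn-punchOut (≢0 j))) (gh j)))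
          (m≤n+m _ _)
  where
  ≢0 : ∀ j → fzero ≢ h j
  ≢0 j e = ∄i (j , sym e)
  h′ : Fin (suc m) → Fin n
  h′ j = punchOut (≢0 j)
  h′-injective : ∀ {j k} → h′ j ≡ h′ k → j ≡ k
  h′-injective e = inj (punchOut-injective (≢0 _) (≢0 _) e)

module Degree (G : Graph) where
  open Graph G

  degree≡count : ∀ u → degree G u ≡ count n (adj u)
  degree≡count u = trans (cong sum (map-tabulate (λ v → v) (λ v → if adj u v then 1 else 0)))
                         (sum-indicators≡count n (adj u))

  injection-into-neighbourhood⇒≤degree : ∀ {m} u (h : Fin m → V G) →
    (∀ {i j} → h i ≡ h j → i ≡ j) → (∀ i → Adjacent G u (h i)) → m ≤ degree G u
  injection-into-neighbourhood⇒≤degree u h inj adj-h =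
    subst (_ ≤_) (sym (degree≡count u)) (injection⇒≤count (adj u) h inj adj-h)

+≡+⇒suc-exchange : ∀ {d d′ n n′} → d + n ≡ d′ + n′ → d ≡ suc d′ ⇔ n′ ≡ suc n
+≡+⇒suc-exchange {d} {d′} {n} {n′} e = mk⇔
  (λ { refl → +-cancelˡ-≡ d′ n′ (suc n) (trans (sym e) (sym (+-suc d′ n))) })
  (λ { refl → +-cancelʳ-≡ n d (suc d′) (trans e (+-suc d′ n)) })

block-end≤ : ∀ {Δ} t (b : Fin (suc Δ)) → toℕ b * t + t ≤ t * (1 + Δ)
block-end≤ {Δ} t b = begin
  toℕ b * t + t ≤⟨ +-monoˡ-≤ t (*-monoˡ-≤ t (≤-pred (toℕ<n b))) ⟩
  Δ * t + t     ≡⟨ +-comm (Δ * t) t ⟩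
  t + Δ * t     ≡⟨ cong (t +_) (*-comm Δ t) ⟩
  t + t * Δ     ≡⟨ sym (*-suc t Δ) ⟩
  t * (1 + Δ)   ∎
  where open ≤-Reasoning

block-< : ∀ {t B B′} (c : Fin t) (c′ : ℕ) → B < B′ → B * t + suc (toℕ c) < B′ * t + suc c′
block-< {t} {B} {B′} c c′ B<B′ = begin-strict
  B * t + suc (toℕ c) ≤⟨ +-monoʳ-≤ (B * t) (toℕ<n c) ⟩
  B * t + t           ≡⟨ +-comm (B * t) t ⟩
  suc B * t           ≤⟨ *-monoˡ-≤ t B<B′ ⟩
  B′ * t              <⟨ m<m+n (B′ * t) (s≤s z≤n) ⟩
  B′ * t + suc c′     ∎
  where open ≤-Reasoning

block-injective : ∀ {t Δ} {b b′ : Fin Δ} (c c′ : Fin t) →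
  toℕ b * t + suc (toℕ c) ≡ toℕ b′ * t + suc (toℕ c′) → b ≡ b′
block-injective {b = b} {b′} c c′ e with <-cmp (toℕ b) (toℕ b′)
... | tri< lt _ _ = ⊥-elim (<-irrefl e (block-< c (toℕ c′) lt))
... | tri≈ _ eq _ = toℕ-injective eq
... | tri> _ _ gt = ⊥-elim (<-irrefl (sym e) (block-< c′ (toℕ c) gt))

clamp : (L : ℕ) → ℕ → Fin (suc L)
clamp L n with n ≤? L
... | yes n≤L = fromℕ< (s≤s n≤L)
... | no  _   = fzero

toℕ-clamp : ∀ {L n} → n ≤ L → toℕ (clamp L n) ≡ n
toℕ-clamp {L} {n} n≤L with n ≤? L
... | yes n≤L′ = toℕ-fromℕ< (s≤s n≤L′)
... | no  n≰L  = ⊥-elim (n≰L n≤L)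

module Paths (G : Graph) where
  open Basics G

  -- An induced path q 0, …, q L; the values of q beyond L are junk.
  record IsInducedPathℕ (L : ℕ) (q : ℕ → V G) : Set where
    field
      injective : ∀ {n n′} → n ≤ L → n′ ≤ L → q n ≡ q n′ → n ≡ n′
      adjacent  : ∀ {n n′} → n ≤ L → n′ ≤ L → Adjacent G (q n) (q n′) ⇔ (n ≡ suc n′ ⊎ n′ ≡ suc n)

  open IsInducedPathℕ public

  walk-down : ∀ {L q} {S : VSet G} → IsInducedPathℕ L q → ∀ {n} → (∀ {k} → k ≤ n → S (q k)) → n ≤ L →
    Reach G S (q n) (q 0)
  walk-down path {zero}  S-q _   = here (S-q z≤n)
  walk-down path {suc n} S-q n<L = step (S-q ≤-refl)
    (Equivalence.from (adjacent path n<L (≤-trans (n≤1+n n) n<L)) (inj₁ refl))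
    (walk-down path (λ k≤n → S-q (m≤n⇒m≤1+n k≤n)) (≤-trans (n≤1+n n) n<L))

  clamp-isInducedPathℕ : ∀ {L p} → IsInducedPath G L p → IsInducedPathℕ L (p ∘ clamp L)
  clamp-isInducedPathℕ {L} {p} (inj , adj) = record
    { injective = λ le le′ e → trans (sym (toℕ-clamp le)) (trans (cong toℕ (inj _ _ e)) (toℕ-clamp le′))
    ; adjacent  = λ {n} {n′} le le′ →
        subst₂ (λ a b → Adjacent G (p (clamp L n)) (p (clamp L n′)) ⇔ (a ≡ suc b ⊎ b ≡ suc a))
               (toℕ-clamp le) (toℕ-clamp le′) (adj _ _)
    }

  reverse-isInducedPathℕ : ∀ {L q} → IsInducedPathℕ L q → IsInducedPathℕ L (λ n → q (L ∸ n))
  reverse-isInducedPathℕ {L} path = record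
    { injective = λ {n} {n′} le le′ e → ∸-cancelˡ-≡ le le′ (injective path (m∸n≤m L n) (m∸n≤m L n′) e)
    ; adjacent  = λ {n} {n′} le le′ → mk⇔
        (λ a → Sum.swap (Sum.map (to (exchange le le′)) (to (exchange le′ le))
                 (Equivalence.to (adjacent path (m∸n≤m L n) (m∸n≤m L n′)) a)))
        (λ o → Equivalence.from (adjacent path (m∸n≤m L n) (m∸n≤m L n′))
                 (Sum.map (from (exchange le le′)) (from (exchange le′ le)) (Sum.swap o)))
    }
    where
    open Equivalence
    exchange : ∀ {n n′} → n ≤ L → n′ ≤ L → L ∸ n ≡ suc (L ∸ n′) ⇔ n′ ≡ suc n
    exchange le le′ = +≡+⇒suc-exchange (trans (m∸n+n≡m le) (sym (m∸n+n≡m le′)))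

  segment-isInducedPath : ∀ {L q} s t → IsInducedPathℕ L q → s + t ≤ L →
    IsInducedPath G t (λ c → q (s + toℕ c))
  segment-isInducedPath {L} s t path s+t≤L =
      (λ c c′ e → toℕ-injective (+-cancelˡ-≡ s _ _ (injective path (in-range c) (in-range c′) e)))
    , λ c c′ → mk⇔
        (λ a → Sum.map (shift⁻¹ c c′) (shift⁻¹ c′ c)
                 (Equivalence.to (adjacent path (in-range c) (in-range c′)) a))
        (λ o → Equivalence.from (adjacent path (in-range c) (in-range c′)) (Sum.map (shift c c′) (shift c′ c) o))
    where
    in-range : ∀ (c : Fin (suc t)) → s + toℕ c ≤ L
    in-range c = ≤-trans (+-monoʳ-≤ s (≤-pred (toℕ<n c))) s+t≤L
    shift : ∀ (c c′ : Fin (suc t)) → toℕ c ≡ suc (toℕ c′) → s + toℕ c ≡ suc (s + toℕ c′)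
    shift c c′ e = trans (cong (s +_) e) (+-suc s (toℕ c′))
    shift⁻¹ : ∀ (c c′ : Fin (suc t)) → s + toℕ c ≡ suc (s + toℕ c′) → toℕ c ≡ suc (toℕ c′)
    shift⁻¹ c c′ e = +-cancelˡ-≡ s _ _ (trans e (sym (+-suc s (toℕ c′))))

  module _ {L} (J : VSet G) {p : Fin (suc L) → V G} where

    joint-first : JointCond G L J p → ℕ → Fin (suc L)
    joint-first (inj₁ _) n = clamp L n
    joint-first (inj₂ _) n = clamp L (L ∸ n)

    joint-first-surjective : (jc : JointCond G L J p) → ∀ i → ∃ λ n → n ≤ L × joint-first jc n ≡ i
    joint-first-surjective (inj₁ _) i = toℕ i , ≤-pred (toℕ<n i) , toℕ-injective (toℕ-clamp (≤-pred (toℕ<n i)))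
    joint-first-surjective (inj₂ _) i = L ∸ toℕ i , m∸n≤m L (toℕ i) ,
      toℕ-injective (trans (toℕ-clamp (m∸n≤m L (L ∸ toℕ i))) (m∸[m∸n]≡n (≤-pred (toℕ<n i))))

    joint-first-isInducedPathℕ : IsInducedPath G L p → (jc : JointCond G L J p) →
      IsInducedPathℕ L (p ∘ joint-first jc)
    joint-first-isInducedPathℕ ind (inj₁ _) = clamp-isInducedPathℕ ind
    joint-first-isInducedPathℕ ind (inj₂ _) = reverse-isInducedPathℕ (clamp-isInducedPathℕ ind)

    joint-first-joint : (jc : JointCond G L J p) → HasNbrIn G J (p (joint-first jc 0))
    joint-first-joint (inj₁ (h , _)) =
      subst (HasNbrIn G J ∘ p) (sym (toℕ-injective (toℕ-clamp {L} {0} z≤n))) h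
    joint-first-joint (inj₂ (h , _)) =
      subst (HasNbrIn G J ∘ p) (sym (toℕ-injective (trans (toℕ-clamp ≤-refl) (sym (toℕ-fromℕ L))))) h

    joint-first-nonjoint : (jc : JointCond G L J p) → ∀ {n} → 1 ≤ n → n ≤ L →
      ¬ HasNbrIn G J (p (joint-first jc n))
    joint-first-nonjoint (inj₁ (_ , r)) 1≤n n≤L =
      r _ (λ e → <⇒≢ 1≤n (sym (trans (sym (toℕ-clamp n≤L)) (cong toℕ e))))
    joint-first-nonjoint (inj₂ (_ , r)) {n} 1≤n n≤L =
      r _ (λ e → <⇒≢ 1≤n (sym (∸-cancelˡ-≡ n≤L z≤n
        (trans (sym (toℕ-clamp (m∸n≤m L n))) (trans (cong toℕ e) (toℕ-fromℕ L))))))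

  open Degree G

  -- Otherwise one neighbour of w from each of the Δ + 1 disjoint blocks would give w degree > Δ.
  free-block : ∀ {Δ} t {q} → MaxDegreeAtMost G Δ → IsInducedPathℕ (t * (1 + Δ)) q → ∀ w →
    ∃ λ (b : Fin (suc Δ)) → ∀ (c : Fin t) → ¬ Adjacent G w (q (toℕ b * t + suc (toℕ c)))
  free-block {Δ} t {q} max-degree path w
    with any? (λ (b : Fin (suc Δ)) → all? (λ c → ¬? (Adjacent? w (q (toℕ b * t + suc (toℕ c))))))
  ... | yes found = found
  ... | no  none  = ⊥-elim (<-irrefl refl (≤-trans
        (injection-into-neighbourhood⇒≤degree w (λ b → vertex b (proj₁ (hit b))) neighbours-distinct
          (λ b → proj₂ (hit b)))
        (max-degree w)))
    where
    vertex : Fin (suc Δ) → Fin t → V G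
    vertex b c = q (toℕ b * t + suc (toℕ c))
    hit : ∀ b → ∃ λ c → Adjacent G w (vertex b c)
    hit b with ¬∀⟶∃¬ t _ (λ c → ¬? (Adjacent? w (vertex b c))) (λ ∀c → none (b , ∀c))
    ... | c , ¬¬adjacent = c , decidable-stable (Adjacent? w (vertex b c)) ¬¬adjacent
    in-range : ∀ b (c : Fin t) → toℕ b * t + suc (toℕ c) ≤ t * (1 + Δ)
    in-range b c = ≤-trans (+-monoʳ-≤ (toℕ b * t) (toℕ<n c)) (block-end≤ t b)
    neighbours-distinct : ∀ {b b′} → vertex b (proj₁ (hit b)) ≡ vertex b′ (proj₁ (hit b′)) → b ≡ b′
    neighbours-distinct {b} {b′} e =
      block-injective _ _ (injective path (in-range b (proj₁ (hit b))) (in-range b′ (proj₁ (hit b′))) e)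

offset : ℕ → Fin 3 → ℕ
offset a fzero               = 0
offset a (fsuc fzero)        = a
offset a (fsuc (fsuc fzero)) = a + a

<ᵇ-true : ∀ {m n} → m < n → (m <ᵇ n) ≡ true
<ᵇ-true m<n = Equivalence.to T-≡ (<⇒<ᵇ m<n)

<ᵇ-false : ∀ {m n} → n ≤ m → (m <ᵇ n) ≡ false
<ᵇ-false {m} {n} n≤m = ¬-not (λ m<ᵇn → <⇒≱ (<ᵇ⇒< m n (Equivalence.from T-≡ m<ᵇn)) n≤m)

spiderDecode-offset : ∀ a b {p} → p < a → spiderDecode a (offset a b + p) ≡ (toℕ b , p)
spiderDecode-offset a fzero p<a rewrite <ᵇ-true p<a = refl
spiderDecode-offset a (fsuc fzero) {p} p<a
  rewrite <ᵇ-false {a + p} {a} (m≤m+n a p) | <ᵇ-true (+-monoʳ-< a p<a) | m+n∸m≡n a p = refl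
spiderDecode-offset a (fsuc (fsuc fzero)) {p} p<a
  rewrite <ᵇ-false {a + a + p} {a} (≤-trans (m≤m+n a a) (m≤m+n (a + a) p))
        | <ᵇ-false {a + a + p} {a + a} (m≤m+n (a + a) p) | m+n∸m≡n (a + a) p = refl

offset+<3* : ∀ a b {p} → p < a → offset a b + p < 3 * a
offset+<3* a fzero p<a = ≤-trans p<a (m≤m+n a _)
offset+<3* a (fsuc fzero) p<a = +-monoʳ-< a (≤-trans p<a (m≤m+n a _))
offset+<3* a (fsuc (fsuc fzero)) {p} p<a rewrite +-assoc a a p =
  +-monoʳ-< a (+-monoʳ-< a (subst (p <_) (sym (+-identityʳ a)) p<a))

<3*⇒offset+ : ∀ a {l} → l < 3 * a → ∃₂ λ b p → p < a × l ≡ offset a b + p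
<3*⇒offset+ a {l} l<3a with l <? a | l <? a + a
... | yes l<a | _        = fzero , l , l<a , refl
... | no  l≮a | yes l<2a =
  fsuc fzero , l ∸ a , subst (l ∸ a <_) (m+n∸m≡n a a) (∸-monoˡ-< l<2a (≮⇒≥ l≮a))
  , sym (m+[n∸m]≡n (≮⇒≥ l≮a))
... | no  _   | no l≮2a  =
  fsuc (fsuc fzero) , l ∸ (a + a) , subst (l ∸ (a + a) <_) (m+n∸m≡n (a + a) a) (∸-monoˡ-< l<3a′ (≮⇒≥ l≮2a))
  , sym (m+[n∸m]≡n (≮⇒≥ l≮2a))
  where
  l<3a′ : l < a + a + a
  l<3a′ = subst (l <_) (trans (cong (λ z → a + (a + z)) (+-identityʳ a)) (sym (+-assoc a a a))) l<3a

spiderAdj-legs⇔ : ∀ a b b′ {p p′} → p < a → p′ < a →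
  spiderAdjℕ a (suc (offset a b + p)) (suc (offset a b′ + p′)) ≡ true ⇔
  (b ≡ b′ × (p ≡ suc p′ ⊎ p′ ≡ suc p))
spiderAdj-legs⇔ a b b′ {p} {p′} p<a p′<a
  rewrite spiderDecode-offset a b p<a | spiderDecode-offset a b′ p′<a = mk⇔
    (λ h → let (same-leg , consecutive) = Equivalence.to T-∧ (Equivalence.from T-≡ h) in
      toℕ-injective (≡ᵇ⇒≡ _ _ same-leg) ,
      Sum.map (≡ᵇ⇒≡ _ _) (≡ᵇ⇒≡ _ _) (Equivalence.to T-∨ consecutive))
    (λ { (refl , o) → Equivalence.to T-≡ (Equivalence.from T-∧
      (≡⇒≡ᵇ (toℕ b) _ refl , Equivalence.from T-∨ (Sum.map (≡⇒≡ᵇ _ _) (≡⇒≡ᵇ _ _) o))) })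

spiderAdj-root-leg⇔ : ∀ a b {p} → p < a → spiderAdjℕ a 0 (suc (offset a b + p)) ≡ true ⇔ p ≡ 0
spiderAdj-root-leg⇔ a b {p} p<a rewrite spiderDecode-offset a b p<a =
  mk⇔ (λ h → ≡ᵇ⇒≡ p 0 (Equivalence.from T-≡ h)) (λ { refl → refl })

module Spider (G : Graph) {X : VSet G} (t : ℕ) (spider : InducesSpider G X (suc t)) where
  open Basics G
  open Paths G

  private
    a N : ℕ
    a = suc t
    N = suc (3 * a)

    f : Fin N → V G
    f = proj₁ spider

    f-injective : ∀ i j → f i ≡ f j → i ≡ j
    f-injective = proj₁ (proj₂ spider)

    X⇔image : ∀ v → X v ⇔ ∃ λ i → f i ≡ v
    X⇔image = proj₁ (proj₂ (proj₂ spider))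

    f-adj : ∀ i j → Graph.adj G (f i) (f j) ≡ spiderAdj a i j
    f-adj = proj₂ (proj₂ (proj₂ spider))

  -- The vertex with spider label k; labels k ≥ N are junk.
  at : ℕ → V G
  at k with k <? N
  ... | yes k<N = f (fromℕ< k<N)
  ... | no  _   = f fzero

  at-fromℕ< : ∀ {k} (k<N : k < N) → at k ≡ f (fromℕ< k<N)
  at-fromℕ< {k} k<N with k <? N
  ... | yes _   = refl
  ... | no  k≮N = ⊥-elim (k≮N k<N)

  at-toℕ : ∀ i → at (toℕ i) ≡ f i
  at-toℕ i = trans (at-fromℕ< (toℕ<n i)) (cong f (fromℕ<-toℕ i (toℕ<n i)))

  at-∈X : ∀ k → X (at k)
  at-∈X k with k <? N
  ... | yes k<N = Equivalence.from (X⇔image _) (fromℕ< k<N , refl)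
  ... | no  _   = Equivalence.from (X⇔image _) (fzero , refl)

  at-injective : ∀ {k k′} → k < N → k′ < N → at k ≡ at k′ → k ≡ k′
  at-injective k<N k′<N e = begin
    _                     ≡⟨ toℕ-fromℕ< k<N ⟨
    toℕ (fromℕ< k<N)      ≡⟨ cong toℕ (f-injective _ _ (trans (sym (at-fromℕ< k<N))
                                                          (trans e (at-fromℕ< k′<N)))) ⟩
    toℕ (fromℕ< k′<N)     ≡⟨ toℕ-fromℕ< k′<N ⟩
    _                     ∎
    where open ≡-Reasoning

  at-adjacent : ∀ {k k′} → k < N → k′ < N → Adjacent G (at k) (at k′) ≡ (spiderAdjℕ a k k′ ≡ true)
  at-adjacent k<N k′<N rewrite at-fromℕ< k<N | at-fromℕ< k′<N | f-adj (fromℕ< k<N) (fromℕ< k′<N)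
                             | toℕ-fromℕ< k<N | toℕ-fromℕ< k′<N = refl

  root : V G
  root = at 0

  -- leg b p is the vertex at distance p + 1 from the root on leg b.
  leg : Fin 3 → ℕ → V G
  leg b p = at (suc (offset a b + p))

  leg-label< : ∀ b {p} → p < a → suc (offset a b + p) < N
  leg-label< b p<a = s≤s (offset+<3* a b p<a)

  root∈X : X root
  root∈X = at-∈X 0

  leg∈X : ∀ b p → X (leg b p)
  leg∈X b p = at-∈X (suc (offset a b + p))

  X⇒root⊎leg : ∀ {v} → X v → v ≡ root ⊎ ∃₂ λ b p → p < a × v ≡ leg b p
  X⇒root⊎leg {v} v∈X with Equivalence.to (X⇔image v) v∈X
  ... | i , refl = classify (toℕ i) (sym (at-toℕ i)) (toℕ<n i)
    where
    classify : ∀ k → f i ≡ at k → k < N → f i ≡ root ⊎ ∃₂ λ b p → p < a × f i ≡ leg b p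
    classify zero    e _   = inj₁ e
    classify (suc l) e l<N with <3*⇒offset+ a (≤-pred l<N)
    ... | b , p , p<a , refl = inj₂ (b , p , p<a , e)

  leg-injective : ∀ b b′ {p p′} → p < a → p′ < a → leg b p ≡ leg b′ p′ → b ≡ b′ × p ≡ p′
  leg-injective b b′ p<a p′<a e =
    toℕ-injective (cong proj₁ same-code) , cong proj₂ same-code
    where
    same-code : (toℕ b , _) ≡ (toℕ b′ , _)
    same-code = begin
      _                                  ≡⟨ spiderDecode-offset a b p<a ⟨
      spiderDecode a (offset a b + _)    ≡⟨ cong (spiderDecode a) (suc-injective
                                              (at-injective (leg-label< b p<a) (leg-label< b′ p′<a) e)) ⟩
      spiderDecode a (offset a b′ + _)   ≡⟨ spiderDecode-offset a b′ p′<a ⟩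
      _                                  ∎
      where open ≡-Reasoning

  root≢leg : ∀ b {p} → p < a → root ≢ leg b p
  root≢leg b p<a e with at-injective (s≤s z≤n) (leg-label< b p<a) e
  ... | ()

  leg-adjacent⇔ : ∀ b b′ {p p′} → p < a → p′ < a →
    Adjacent G (leg b p) (leg b′ p′) ⇔ (b ≡ b′ × (p ≡ suc p′ ⊎ p′ ≡ suc p))
  leg-adjacent⇔ b b′ p<a p′<a =
    subst (_⇔ _) (sym (at-adjacent (leg-label< b p<a) (leg-label< b′ p′<a))) (spiderAdj-legs⇔ a b b′ p<a p′<a)

  root-adjacent⇔ : ∀ b {p} → p < a → Adjacent G root (leg b p) ⇔ p ≡ 0
  root-adjacent⇔ b p<a =
    subst (_⇔ _) (sym (at-adjacent (s≤s z≤n) (leg-label< b p<a))) (spiderAdj-root-leg⇔ a b p<a)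

  leg-isInducedPathℕ : ∀ b → IsInducedPathℕ t (leg b)
  leg-isInducedPathℕ b = record
    { injective = λ p≤t p′≤t e → proj₂ (leg-injective b b (s≤s p≤t) (s≤s p′≤t) e)
    ; adjacent  = λ p≤t p′≤t → mk⇔
        (λ adj → proj₂ (Equivalence.to (leg-adjacent⇔ b b (s≤s p≤t) (s≤s p′≤t)) adj))
        (λ o → Equivalence.from (leg-adjacent⇔ b b (s≤s p≤t) (s≤s p′≤t)) (refl , o))
    }

  root-adjacent-leg : ∀ b → Adjacent G root (leg b 0)
  root-adjacent-leg b = Equivalence.from (root-adjacent⇔ b (s≤s z≤n)) refl

  leaf⇒leg-end : ∀ {x} → IsLeafOf G X x → ∃ λ b → x ≡ leg b t
  leaf⇒leg-end leaf with X⇒root⊎leg (proj₁ leaf)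
  ... | inj₁ refl with leg-injective fzero (fsuc fzero) (s≤s z≤n) (s≤s z≤n)
        (leaf-neighbours-equal leaf (leg∈X fzero 0) (leg∈X (fsuc fzero) 0)
          (root-adjacent-leg fzero) (root-adjacent-leg (fsuc fzero)))
  ...   | () , _
  leaf⇒leg-end leaf | inj₂ (b , p , p<a , refl) with m≤n⇒m<n∨m≡n (≤-pred p<a)
  ...   | inj₂ refl = b , refl
  ...   | inj₁ p<t  = ⊥-elim (no-predecessor p refl)
    where
    successor : Adjacent G (leg b p) (leg b (suc p))
    successor = Equivalence.from (leg-adjacent⇔ b b p<a (s≤s p<t)) (refl , inj₂ refl)
    no-predecessor : ∀ q → q ≡ p → ⊥
    no-predecessor zero refl = root≢leg b (s≤s p<t) (leaf-neighbours-equal leaf root∈X (leg∈X b 1)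
      (Adjacent-sym (root-adjacent-leg b)) successor)
    no-predecessor (suc q) refl with leg-injective b b q<a (s≤s p<t) (leaf-neighbours-equal leaf (leg∈X b q)
      (leg∈X b (suc p)) (Equivalence.from (leg-adjacent⇔ b b p<a q<a) (refl , inj₁ refl)) successor)
      where
      q<a : q < a
      q<a = ≤-trans (n≤1+n _) p<a
    ... | _ , ()

gap-nonadjacent : ∀ {n s k} → n < s → s < k → ¬ (n ≡ suc k ⊎ k ≡ suc n)
gap-nonadjacent n<s s<k (inj₁ refl) = <-asym (<-trans n<s s<k) (n<1+n _)
gap-nonadjacent n<s s<k (inj₂ refl) = <⇒≱ s<k n<s

module Extension
  {Δ t m : ℕ} {G : Graph} (max-degree : MaxDegreeAtMost G Δ)
  {X : VSet G} (spider : InducesSpider G X (suc t)) {x : V G} (leaf : IsLeafOf G X x)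
  where
  open Basics G
  open Paths G
  open Spider G t spider

  L : ℕ
  L = t * (1 + Δ)

  S : VSet G
  S v = ¬ (ClosedNbhd G (λ u → X u × u ≢ x) v × v ≢ x)

  C : VSet G
  C = Component G S x

  x∈S : S x
  x∈S (_ , x≢x) = x≢x refl

  C-meets-X-only-at-x : ∀ {v u} → C v → X u → u ≢ x → v ≡ u ⊎ Adjacent G v u → v ≡ x
  C-meets-X-only-at-x {v} {u} v∈C u∈X u≢x v≈u with v ≟ᶠ x
  ... | yes v≡x = v≡x
  ... | no  v≢x = ⊥-elim (reach-target v∈C (in-neighbourhood v≈u , v≢x))
    where
    in-neighbourhood : v ≡ u ⊎ Adjacent G v u → ClosedNbhd G (λ u → X u × u ≢ x) v
    in-neighbourhood (inj₁ refl) = inj₁ (u∈X , u≢x)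
    in-neighbourhood (inj₂ vu)   = inj₂ (u , (u∈X , u≢x) , vu)

  bx : Fin 3
  bx = proj₁ (leaf⇒leg-end leaf)

  x≡leg : x ≡ leg bx t
  x≡leg = proj₂ (leaf⇒leg-end leaf)

  other-leg≢x : ∀ {b p} → b ≢ bx → p < suc t → leg b p ≢ x
  other-leg≢x {b} b≢bx p<a e = b≢bx (proj₁ (leg-injective b bx p<a (n<1+n t) (trans e x≡leg)))

  module _
    (J : VSet G) (J? : ∀ v → Dec (J v)) (P : Fin (suc m) → Fin (suc L) → V G)
    (J⊆C : ∀ v → J v → C v) (J-connected : Connected G J)
    (P⊆C : ∀ j a → C (P j a)) (P∉J : ∀ j a → ¬ J (P j a))
    (P-induced : ∀ j → IsInducedPath G L (P j))
    (P-separated : ∀ j j′ → j ≢ j′ → ∀ a a′ → (P j a ≢ P j′ a′) × ¬ Adjacent G (P j a) (P j′ a′))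
    (P-joint : ∀ j → JointCond G L J (P j))
    where

    Q : Fin (suc m) → ℕ → V G
    Q j n = P j (joint-first J (P-joint j) n)

    Q-path : ∀ j → IsInducedPathℕ L (Q j)
    Q-path j = joint-first-isInducedPathℕ J (P-induced j) (P-joint j)

    Z : VSet G
    Z v = J v ⊎ ∃₂ λ j a → P j a ≡ v

    N[Z] : VSet G
    N[Z] = ClosedNbhd G Z

    N[Z]? : ∀ v → Dec (N[Z] v)
    N[Z]? v = Z? v ⊎-dec any? (λ z → Z? z ×-dec Adjacent? v z)
      where
      Z? : ∀ v → Dec (Z v)
      Z? v = J? v ⊎-dec any? (λ j → any? (λ a → P j a ≟ᶠ v))

    CoreOrPath : Fin (suc m) → VSet G
    CoreOrPath i v = J v ⊎ ∃ λ a → P i a ≡ v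

    touched-path : ∀ {w} → N[Z] w →
      ∃ λ i → ClosedNbhd G (CoreOrPath i) w × (∀ j → j ≢ i → ∀ a → P j a ≢ w)
    touched-path {w} w∈N[Z] with J? w | any? (λ j → any? (λ a → P j a ≟ᶠ w)) | w∈N[Z]
    ... | yes w∈J | _ | _ = fzero , inj₁ (inj₁ w∈J) , λ j _ a e → P∉J j a (subst J (sym e) w∈J)
    ... | no _ | yes (i , a , e) | _ =
      i , inj₁ (inj₂ (a , e)) , λ j j≢i a′ e′ → proj₁ (P-separated j i j≢i a′ a) (trans e′ (sym e))
    ... | no w∉J | no w∉P | inj₁ w∈Z = ⊥-elim ([ w∉J , w∉P ] w∈Z)
    ... | no w∉J | no w∉P | inj₂ (z , inj₁ z∈J , wz) =
      fzero , inj₂ (z , inj₁ z∈J , wz) , λ j _ a e → w∉P (j , a , e)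
    ... | no w∉J | no w∉P | inj₂ (z , inj₂ (i , a , e) , wz) =
      i , inj₂ (z , inj₂ (a , e) , wz) , λ j _ a e → w∉P (j , a , e)

    Approach : V G → VSet G
    Approach w v = S v × (v ≡ w ⊎ ¬ N[Z] v)

    module Construction
      (w : V G) (i : Fin (suc m)) (route : Reach G (Approach w) x w)
      (touch : ClosedNbhd G (CoreOrPath i) w) (avoid : ∀ j → j ≢ i → ∀ a → P j a ≢ w)
      (block : Fin (suc m) → Fin (suc Δ))
      (free : ∀ j (c : Fin t) → ¬ Adjacent G w (Q j (toℕ (block j) * t + suc (toℕ c))))
      where

      -- The subpath of Q j kept for the new creature starts at position s j.
      s : Fin (suc m) → ℕ
      s j = toℕ (block j) * t

      s≤L : ∀ j → s j ≤ L
      s≤L j = ≤-trans (m≤m+n _ t) (block-end≤ t (block j))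

      Stem : VSet G
      Stem v = v ≡ root ⊎ ∃ λ p → p ≤ t × v ≡ leg bx p

      data J′ (v : V G) : Set where
        old      : J v → J′ v
        approach : Reach G (Approach w) x v → J′ v
        stem     : Stem v → J′ v
        absorbed : ∀ a → P i a ≡ v → J′ v
        prefix   : ∀ j n → j ≢ i → n < s j → Q j n ≡ v → J′ v

      prefix≤L : ∀ {j n} → n < s j → n ≤ L
      prefix≤L {j} n<s = ≤-trans (<⇒≤ n<s) (s≤L j)

      j₀ : V G
      j₀ = proj₁ (proj₁ J-connected)

      old⇝j₀ : ∀ {v} → J v → Reach G J′ v j₀
      old⇝j₀ v∈J = reach-mono old (proj₂ J-connected _ _ v∈J (proj₂ (proj₁ J-connected)))

      path⇝j₀ : ∀ j {n} → n ≤ L → (∀ {k} → k ≤ n → J′ (Q j k)) → Reach G J′ (Q j n) j₀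
      path⇝j₀ j n≤L down with joint-first-joint J (P-joint j)
      ... | u , u∈J , joint = reach-trans (walk-down (Q-path j) down n≤L) (step (down z≤n) joint (old⇝j₀ u∈J))

      core-or-path⇝j₀ : ∀ {v} → CoreOrPath i v → Reach G J′ v j₀
      core-or-path⇝j₀ (inj₁ v∈J) = old⇝j₀ v∈J
      core-or-path⇝j₀ (inj₂ (a , refl)) with joint-first-surjective J (P-joint i) a
      ... | n , n≤L , refl = path⇝j₀ i n≤L (λ _ → absorbed _ refl)

      x⇝j₀ : Reach G J′ x j₀
      x⇝j₀ = reach-trans (reach-mono approach (reach-prefixes route)) (touched⇝j₀ touch)
        where
        touched⇝j₀ : ClosedNbhd G (CoreOrPath i) w → Reach G J′ w j₀
        touched⇝j₀ (inj₁ w∈B)           = core-or-path⇝j₀ w∈B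
        touched⇝j₀ (inj₂ (_ , z∈B , wz)) = step (approach route) wz (core-or-path⇝j₀ z∈B)

      stem⇝x : ∀ {p} → p ≤ t → Reach G J′ (leg bx p) x
      stem⇝x p≤t = subst (Reach G J′ _) (sym x≡leg) (reach-trans
        (walk-down (leg-isInducedPathℕ bx) (λ k≤p → stem (inj₂ (_ , ≤-trans k≤p p≤t , refl))) p≤t)
        (reach-sym (walk-down (leg-isInducedPathℕ bx) (λ k≤t → stem (inj₂ (_ , k≤t , refl))) ≤-refl)))

      J′⇝j₀ : ∀ {v} → J′ v → Reach G J′ v j₀
      J′⇝j₀ (old v∈J)                      = old⇝j₀ v∈J
      J′⇝j₀ (approach r)                   = reach-trans (reach-sym (reach-mono approach (reach-prefixes r))) x⇝j₀
      J′⇝j₀ (stem (inj₁ refl))             =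
        step (stem (inj₁ refl)) (root-adjacent-leg bx) (reach-trans (stem⇝x z≤n) x⇝j₀)
      J′⇝j₀ (stem (inj₂ (_ , p≤t , refl))) = reach-trans (stem⇝x p≤t) x⇝j₀
      J′⇝j₀ (absorbed a refl)              = core-or-path⇝j₀ (inj₂ (a , refl))
      J′⇝j₀ (prefix j n j≢i n<s refl) =
        path⇝j₀ j (prefix≤L n<s) (λ k≤n → prefix j _ j≢i (≤-<-trans k≤n n<s) refl)

      J′-connected : Connected G J′
      J′-connected = (j₀ , old (proj₂ (proj₁ J-connected))) ,
        λ u v u∈J′ v∈J′ → reach-trans (J′⇝j₀ u∈J′) (reach-sym (J′⇝j₀ v∈J′))

      x∈Approach : Approach w x
      x∈Approach = reach-source route

      other-path∉Approach : ∀ {j} → j ≢ i → ∀ a → ¬ Approach w (P j a)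
      other-path∉Approach j≢i a (_ , inj₁ e)        = avoid _ j≢i a e
      other-path∉Approach j≢i a (_ , inj₂ v∉N[Z]) = v∉N[Z] (inj₁ (inj₂ (_ , a , refl)))

      other-path≢x : ∀ {j} → j ≢ i → ∀ a → P j a ≢ x
      other-path≢x j≢i a e = other-path∉Approach j≢i a (subst (Approach w) (sym e) x∈Approach)

      other-path-avoids-X : ∀ {j u} → j ≢ i → ∀ a → X u → u ≢ x → ¬ (P j a ≡ u ⊎ Adjacent G (P j a) u)
      other-path-avoids-X j≢i a u∈X u≢x = other-path≢x j≢i a ∘ C-meets-X-only-at-x (P⊆C _ a) u∈X u≢x

      other-path∉X : ∀ {j} → j ≢ i → ∀ a → ¬ X (P j a)
      other-path∉X j≢i a v∈X = other-path-avoids-X j≢i a v∈X (other-path≢x j≢i a) (inj₁ refl)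

      Stem⊆X : ∀ {v} → Stem v → X v
      Stem⊆X (inj₁ refl)            = root∈X
      Stem⊆X (inj₂ (p , _ , refl)) = leg∈X bx p

      J′⇒C⊎Stem : ∀ {v} → J′ v → C v ⊎ Stem v
      J′⇒C⊎Stem (old v∈J)                   = inj₁ (J⊆C _ v∈J)
      J′⇒C⊎Stem (approach r)                = inj₁ (reach-mono proj₁ r)
      J′⇒C⊎Stem (stem v∈Stem)               = inj₂ v∈Stem
      J′⇒C⊎Stem (absorbed a refl)           = inj₁ (P⊆C i a)
      J′⇒C⊎Stem (prefix j _ _ _ refl)       = inj₁ (P⊆C j _)

      window : Fin (suc m) → Fin (suc t) → V G
      window j c = Q j (s j + toℕ c)

      window-in-range : ∀ j (c : Fin (suc t)) → s j + toℕ c ≤ L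
      window-in-range j c = ≤-trans (+-monoʳ-≤ (s j) (≤-pred (toℕ<n c))) (block-end≤ t (block j))

      window∉J′ : ∀ {j} → j ≢ i → ∀ c → ¬ J′ (window j c)
      window∉J′ j≢i c (old v∈J)         = P∉J _ _ v∈J
      window∉J′ j≢i c (approach r)      = other-path∉Approach j≢i _ (reach-target r)
      window∉J′ j≢i c (stem v∈Stem)     = other-path∉X j≢i _ (Stem⊆X v∈Stem)
      window∉J′ j≢i c (absorbed a e)    = proj₁ (P-separated i _ (j≢i ∘ sym) a _) e
      window∉J′ {j} j≢i c (prefix j′ n _ n<s e) with j′ ≟ᶠ j
      ... | no  j′≢j = proj₁ (P-separated j′ j j′≢j _ _) e
      ... | yes refl = <⇒≱ n<s (≤-trans (m≤m+n (s j) (toℕ c))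
                         (≤-reflexive (sym (injective (Q-path j) (prefix≤L n<s) (window-in-range j c) e))))

      other-path-joint : ∀ {j n} → j ≢ i → n ≤ s j → HasNbrIn G J′ (Q j n)
      other-path-joint {j} {zero} j≢i _ with joint-first-joint J (P-joint j)
      ... | u , u∈J , joint = u , old u∈J , joint
      other-path-joint {j} {suc n} j≢i n<s =
        Q j n , prefix j n j≢i n<s refl ,
        Equivalence.from (adjacent (Q-path j) (≤-trans n<s (s≤L j)) (prefix≤L n<s)) (inj₁ refl)

      window-inner-isolated : ∀ {j} → j ≢ i → ∀ (c : Fin t) → ¬ HasNbrIn G J′ (window j (fsuc c))
      window-inner-isolated {j} j≢i c (u , u∈J′ , adj) = isolated u∈J′
        where
        n≤L : s j + suc (toℕ c) ≤ L
        n≤L = window-in-range j (fsuc c)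
        from-approach : Approach w u → ⊥
        from-approach (_ , inj₁ refl) = free j c (Adjacent-sym adj)
        from-approach (_ , inj₂ u∉N[Z]) = u∉N[Z] (inj₂ (_ , inj₂ (j , _ , refl) , Adjacent-sym adj))
        isolated : J′ u → ⊥
        isolated (old u∈J) = joint-first-nonjoint J (P-joint j)
          (subst (1 ≤_) (sym (+-suc (s j) (toℕ c))) (s≤s z≤n)) n≤L (u , u∈J , adj)
        isolated (approach r) = from-approach (reach-target r)
        isolated (stem u∈Stem) with u ≟ᶠ x
        -- x starts the walk to w, so it is w itself or lies outside N[Z].
        ... | yes refl = from-approach x∈Approach
        ... | no  u≢x  = other-path-avoids-X j≢i _ (Stem⊆X u∈Stem) u≢x (inj₂ adj)
        isolated (absorbed a refl) = proj₂ (P-separated i j (j≢i ∘ sym) a _) (Adjacent-sym adj)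
        isolated (prefix j′ n′ _ n′<s refl) with j′ ≟ᶠ j
        ... | no  j′≢j = proj₂ (P-separated j′ j j′≢j _ _) (Adjacent-sym adj)
        ... | yes refl = gap-nonadjacent n′<s (m<m+n (s j) (s≤s z≤n))
          (Equivalence.to (adjacent (Q-path j) (prefix≤L n′<s) n≤L) (Adjacent-sym adj))

      window-jointCond : ∀ {j} → j ≢ i → JointCond G t J′ (window j)
      window-jointCond {j} j≢i =
        inj₁ (subst (HasNbrIn G J′ ∘ Q j) (sym (+-identityʳ (s j))) (other-path-joint j≢i ≤-refl) , nonjoint)
        where
        nonjoint : ∀ c → c ≢ fzero → ¬ HasNbrIn G J′ (window j c)
        nonjoint fzero    c≢0 = ⊥-elim (c≢0 refl)
        nonjoint (fsuc c) _   = window-inner-isolated j≢i c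

      other-leg∉J′ : ∀ {b} → b ≢ bx → ∀ (c : Fin (suc t)) → ¬ J′ (leg b (toℕ c))
      other-leg∉J′ {b} b≢bx c v∈J′ with J′⇒C⊎Stem v∈J′
      ... | inj₁ v∈C = other-leg≢x b≢bx (toℕ<n c)
        (C-meets-X-only-at-x v∈C (leg∈X b _) (other-leg≢x b≢bx (toℕ<n c)) (inj₁ refl))
      ... | inj₂ (inj₁ e)             = root≢leg b (toℕ<n c) (sym e)
      ... | inj₂ (inj₂ (_ , p≤t , e)) = b≢bx (proj₁ (leg-injective b bx (toℕ<n c) (s≤s p≤t) e))

      other-leg-inner-isolated : ∀ {b} → b ≢ bx → ∀ (c : Fin t) → ¬ HasNbrIn G J′ (leg b (suc (toℕ c)))
      other-leg-inner-isolated {b} b≢bx c (u , u∈J′ , adj) with J′⇒C⊎Stem u∈J′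
      ... | inj₁ u∈C = b≢bx (proj₁ (Equivalence.to (leg-adjacent⇔ b bx p<a (n<1+n t))
            (subst (Adjacent G _) (trans u≡x x≡leg) adj)))
        where
        p<a : suc (toℕ c) < suc t
        p<a = s≤s (toℕ<n c)
        u≡x : u ≡ x
        u≡x = C-meets-X-only-at-x u∈C (leg∈X b _) (other-leg≢x b≢bx p<a) (inj₂ (Adjacent-sym adj))
      ... | inj₂ (inj₁ refl) with Equivalence.to (root-adjacent⇔ b (s≤s (toℕ<n c))) (Adjacent-sym adj)
      ...   | ()
      other-leg-inner-isolated {b} b≢bx c (u , u∈J′ , adj) | inj₂ (inj₂ (_ , p≤t , refl)) =
        b≢bx (proj₁ (Equivalence.to (leg-adjacent⇔ b bx (s≤s (toℕ<n c)) (s≤s p≤t)) adj))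

      other-leg-jointCond : ∀ {b} → b ≢ bx → JointCond G t J′ (λ c → leg b (toℕ c))
      other-leg-jointCond {b} b≢bx =
        inj₁ ((root , stem (inj₁ refl) , Adjacent-sym (root-adjacent-leg b)) , nonjoint)
        where
        nonjoint : ∀ c → c ≢ fzero → ¬ HasNbrIn G J′ (leg b (toℕ c))
        nonjoint fzero    c≢0 = ⊥-elim (c≢0 refl)
        nonjoint (fsuc c) _   = other-leg-inner-isolated b≢bx c

      legs-separated : ∀ {b b′} → b ≢ b′ → ∀ (c c′ : Fin (suc t)) →
        (leg b (toℕ c) ≢ leg b′ (toℕ c′)) × ¬ Adjacent G (leg b (toℕ c)) (leg b′ (toℕ c′))
      legs-separated {b} {b′} b≢b′ c c′ =
          (λ e → b≢b′ (proj₁ (leg-injective b b′ (toℕ<n c) (toℕ<n c′) e)))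
        , (λ adj → b≢b′ (proj₁ (Equivalence.to (leg-adjacent⇔ b b′ (toℕ<n c) (toℕ<n c′)) adj)))

      window-leg-separated : ∀ {j b} → j ≢ i → b ≢ bx → ∀ c (c′ : Fin (suc t)) →
        (window j c ≢ leg b (toℕ c′)) × ¬ Adjacent G (window j c) (leg b (toℕ c′))
      window-leg-separated {j} {b} j≢i b≢bx c c′ = (λ e → avoids (inj₁ e)) , (λ adj → avoids (inj₂ adj))
        where
        avoids : ¬ (window j c ≡ leg b (toℕ c′) ⊎ Adjacent G (window j c) (leg b (toℕ c′)))
        avoids = other-path-avoids-X j≢i _ (leg∈X b _) (other-leg≢x b≢bx (toℕ<n c′))

      new-path : Fin 2 ⊎ Fin m → Fin (suc t) → V G
      new-path (inj₁ l) c = leg (punchIn bx l) (toℕ c)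
      new-path (inj₂ j)   = window (punchIn i j)

      new-path-∉J′ : ∀ ι c → ¬ J′ (new-path ι c)
      new-path-∉J′ (inj₁ l) = other-leg∉J′ (punchInᵢ≢i bx l)
      new-path-∉J′ (inj₂ j) = window∉J′ (punchInᵢ≢i i j)

      new-path-induced : ∀ ι → IsInducedPath G t (new-path ι)
      new-path-induced (inj₁ l) = segment-isInducedPath 0 t (leg-isInducedPathℕ (punchIn bx l)) ≤-refl
      new-path-induced (inj₂ j) = segment-isInducedPath (s (punchIn i j)) t (Q-path _) (block-end≤ t (block (punchIn i j)))

      new-path-jointCond : ∀ ι → JointCond G t J′ (new-path ι)
      new-path-jointCond (inj₁ l) = other-leg-jointCond (punchInᵢ≢i bx l)
      new-path-jointCond (inj₂ j) = window-jointCond (punchInᵢ≢i i j)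

      new-paths-separated : ∀ {ι ι′} → ι ≢ ι′ → ∀ c c′ →
        (new-path ι c ≢ new-path ι′ c′) × ¬ Adjacent G (new-path ι c) (new-path ι′ c′)
      new-paths-separated {inj₁ l} {inj₁ l′} ι≢ι′ =
        legs-separated (ι≢ι′ ∘ cong inj₁ ∘ punchIn-injective bx l l′)
      new-paths-separated {inj₁ l} {inj₂ j} _ c c′ =
        separated-sym (window-leg-separated (punchInᵢ≢i i j) (punchInᵢ≢i bx l) c′ c)
      new-paths-separated {inj₂ j} {inj₁ l} _ =
        window-leg-separated (punchInᵢ≢i i j) (punchInᵢ≢i bx l)
      new-paths-separated {inj₂ j} {inj₂ j′} ι≢ι′ c c′ =
        P-separated _ _ (ι≢ι′ ∘ cong inj₂ ∘ punchIn-injective i j j′) _ _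

      creature : CreatureIn G (λ _ → ⊤) (2 + m) t
      creature =
          s≤s z≤n , J′ , new-path ∘ splitAt 2 , (λ _ _ → tt) , J′-connected , (λ _ _ → tt)
        , new-path-∉J′ ∘ splitAt 2 , new-path-induced ∘ splitAt 2
        , (λ ι ι′ ι≢ι′ → new-paths-separated (ι≢ι′ ∘ splitAt-injective))
        , new-path-jointCond ∘ splitAt 2
        where
        splitAt-injective : ∀ {ι ι′} → splitAt 2 {m} ι ≡ splitAt 2 ι′ → ι ≡ ι′
        splitAt-injective {ι} {ι′} e =
          trans (sym (join-splitAt 2 m ι)) (trans (cong (join 2 m) e) (join-splitAt 2 m ι′))

    extend : ∀ {w} → Reach G (Approach w) x w → N[Z] w → CreatureIn G (λ _ → ⊤) (2 + m) t
    extend {w} route w∈N[Z] with touched-path w∈N[Z]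
    ... | i , touch , avoid = Construction.creature w i route touch avoid (proj₁ ∘ free) (proj₂ ∘ free)
      where
      free : ∀ j → ∃ λ (b : Fin (suc Δ)) → ∀ (c : Fin t) → ¬ Adjacent G w (Q j (toℕ b * t + suc (toℕ c)))
      free j = free-block t max-degree (Q-path j) w

    extended-creature : CreatureIn G (λ _ → ⊤) (2 + m) t
    extended-creature with first-hit N[Z]? (J⊆C _ j₀∈J) (inj₁ (inj₁ j₀∈J))
      where
      j₀∈J : J (proj₁ (proj₁ J-connected))
      j₀∈J = proj₂ (proj₁ J-connected)
    ... | inj₁ x∈N[Z] = extend (here (x∈S , inj₁ refl)) x∈N[Z]
    ... | inj₂ (_ , w , r , adj , w∈N[Z] , w∈S) =
      extend (reach-snoc (reach-mono (λ (v∈S , v∉N[Z]) → v∈S , inj₂ v∉N[Z]) r) adj (w∈S , inj₁ refl)) w∈N[Z]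

theorem6p2 : (Δ k t : ℕ) (G : Graph) →
    MaxDegreeAtMost G Δ →
    ¬ CreatureIn G (λ _ → ⊤) k t →
    (X : VSet G) → InducesSpider G X (suc t) →
    (x : V G) → IsLeafOf G X x →
    ¬ CreatureIn G
        (Component G
          (λ v → ¬ (ClosedNbhd G (λ u → X u × u ≢ x) v × v ≢ x)) x)
        (k ∸ 1) (t * (1 + Δ))
theorem6p2 Δ zero          t G _ _ X _ x _ (() , _)
theorem6p2 Δ (suc zero)    t G _ _ X _ x _ (() , _)
theorem6p2 Δ (suc (suc m)) t G max-degree no-creature X spider x leaf
  (_ , J , P , J⊆C , J-connected , P⊆C , P∉J , P-induced , P-separated , P-joint) =
  -- J is an arbitrary predicate, but as the goal is ⊥ we may assume it decidable.
  ¬¬-decidable _ J λ J? → no-creature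
    (Extension.extended-creature max-degree spider leaf J J? P J⊆C J-connected P⊆C P∉J P-induced P-separated P-joint)
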